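{- Let $M$ be a DFA with $n \ge 2$ states. If $L(M)$ is not subword-closed, there exists a witness $(v,w)$ to the failure of subword-closure with $|w| \le n$. Furthermore, this is the best possible bound: there exists a DFA with $n$ states over a one-letter alphabet whose language is not subword-closed and every witness $(v,w)$ of which satisfies $|w| \ge n$.
   Context: A word $v$ is a subword of $w$ if $v$ can be obtained from $w$ by deleting some (not necessarily contiguous) letters. $L$ is subword-closed if $w \in L$ and $v$ a subword of $w$ imply $v \in L$. A witness to the failure of subword-closure is a pair $(v,w)$ with $w \in L$, $v \notin L$, $v$ a subword of $w$. -}

module Defs where

open import Data.Nat using (ℕ)
open import Data.Fin using (Fin)
open import Data.Bool using (Bool; true)
open import Data.List using (List; []; _∷_; foldl)
open import Data.Product using (Σ; _×_; ∃)
open import Relation.Binary.PropositionalEquality using (_≡_)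
open import Relation.Nullary using (¬_)
open import Data.List.Relation.Binary.Sublist.Propositional using (_⊆_)

record DFA (n k : ℕ) : Set where
  field
    δ      : Fin n → Fin k → Fin n
    start  : Fin n
    final  : Fin n → Bool

open DFA public

δ* : ∀ {n k} → DFA n k → Fin n → List (Fin k) → Fin n
δ* M q w = foldl (δ M) q w

Accepts : ∀ {n k} → DFA n k → List (Fin k) → Set
Accepts M w = final M (δ* M (start M) w) ≡ true

_≼_ : ∀ {A : Set} → List A → List A → Set
v ≼ w = v ⊆ w

SubwordClosed : ∀ {n k} → DFA n k → Set
SubwordClosed M = ∀ v w → Accepts M w → v ≼ w → Accepts M v

Witness : ∀ {n k} → DFA n k → List (Fin k) → List (Fin k) → Set
Witness M v w = Accepts M w × ¬ Accepts M v × v ≼ w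

-- Upper bound: delete from w a letter not needed for v, w = x a y.  Either x y is accepted
-- and (v , x y) is a shorter witness, or x y is rejected.  In the latter case, if |w| > n,
-- the run on x y repeats a state, so x y = P b Q R with P b Q looping back to the state
-- of P, and P R is rejected as well.  If the loop b Q lies inside x, cutting it out of w
-- gives the shorter witness (P R , P x' a y).  Otherwise the loop contains some letter c
-- of y; deleting c from w gives a word that either is accepted, and is then a shorter
-- witness above P R, or is rejected, and then w is again a single deletion of a rejected
-- word, now strictly further to the right.
--
-- Lower bound: the unary automaton counting modulo n and rejecting exactly the lengths
-- congruent to n - 1; a witness pairs a rejected and an accepted length, and below n the
-- only rejected length is n - 1, so an accepted word above it must have length at least n.
module Submission where

open import Defs
open import Data.Nat using (ℕ; zero; suc; _+_; _≤_; _≥_; _<_; z≤n; s≤s; _≤?_; _≟_; NonZero)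
open import Data.Nat.Properties
  using (≤-pred; ≤-<-trans; ≤-antisym; ≰⇒>; ≮⇒≥; +-identityʳ; +-suc; n<1+n; <⇒≢)
open import Data.Nat.DivMod using (_%_; _mod_; %-distribˡ-+; m%n%n≡m%n; m<n⇒m%n≡m; n%n≡0; m%n<n)
open import Data.Nat.Induction using (<-wellFounded)
open import Data.Fin as Fin using (Fin; toℕ)
open import Data.Fin.Properties using (pigeonhole; toℕ<n; toℕ-fromℕ<; any?)
open import Data.List using (List; []; _∷_; _++_; length; take; drop; replicate)
open import Data.List.Properties
  using (∷-injective; ++-assoc; take++drop≡id; foldl-++; length-++-≤ʳ; length-replicate)
open import Data.List.Relation.Binary.Sublist.Propositional using (_⊆_; []; _∷_; _∷ʳ_; ⊆-refl; ⊆-trans)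
open import Data.List.Relation.Binary.Sublist.Propositional.Properties
  using (++⁺; ++⁺ˡ; length-mono-≤)
open import Data.Bool using (true)
open import Data.Bool.Properties using (T-≡) renaming (_≟_ to _≟ᵇ_)
open import Data.Product using (_×_; _,_; ∃; ∃-syntax)
open import Data.Sum using (_⊎_; inj₁; inj₂)
open import Data.Empty using (⊥-elim)
open import Function using (_∘_; case_of_; _⇔_; mk⇔; Equivalence)
open import Induction.WellFounded using (Acc; acc)
open import Relation.Nullary using (¬_; Dec; yes; no; ¬?)
open import Relation.Nullary.Decidable
  using (map′; _×-dec_; isNo; decidable-stable; toWitnessFalse; fromWitnessFalse)
open import Relation.Binary.PropositionalEquality
  using (_≡_; _≢_; refl; sym; trans; cong; subst; module ≡-Reasoning)

open Equivalence using (to; from)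
open ≡-Reasoning

module _ {A : Set} where

  length-insert : ∀ (x : List A) a y → length (x ++ a ∷ y) ≡ suc (length (x ++ y))
  length-insert []      a y = refl
  length-insert (_ ∷ x) a y = cong suc (length-insert x a y)

  delete-segment-< : ∀ (P : List A) b Q R → length (P ++ R) < length (P ++ b ∷ Q ++ R)
  delete-segment-< []      b Q R = s≤s (length-++-≤ʳ R {Q})
  delete-segment-< (_ ∷ P) b Q R = s≤s (delete-segment-< P b Q R)

  delete-⊆ : ∀ (x : List A) a y → x ++ y ⊆ x ++ a ∷ y
  delete-⊆ x a y = ++⁺ (⊆-refl {x = x}) (a ∷ʳ ⊆-refl)

  ⊆-≢-deletion : ∀ {v w : List A} → v ⊆ w → v ≢ w →
                 ∃ λ x → ∃ λ a → ∃ λ y → w ≡ x ++ a ∷ y × v ⊆ x ++ y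
  ⊆-≢-deletion []           v≢w = ⊥-elim (v≢w refl)
  ⊆-≢-deletion (a ∷ʳ v⊆w)   _   = [] , a , _ , refl , v⊆w
  ⊆-≢-deletion (refl ∷ v⊆w) v≢w
    with x , a , y , w≡ , v⊆xy ← ⊆-≢-deletion v⊆w (v≢w ∘ cong (_ ∷_))
    = _ ∷ x , a , y , cong (_ ∷_) w≡ , refl ∷ v⊆xy

  take-<-split : ∀ (v : List A) {i j} → i < j → j ≤ length v →
                 ∃ λ b → ∃ λ Q → ∃ λ R → v ≡ take i v ++ b ∷ Q ++ R × take j v ≡ take i v ++ b ∷ Q
  take-<-split (c ∷ v) {zero}  {suc j} _ _ = c , take j v , drop j v , cong (c ∷_) (sym (take++drop≡id j v)) , refl
  take-<-split (c ∷ v) {suc i} {suc j} (s≤s i<j) (s≤s j≤v)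
    with b , Q , R , v≡ , take≡ ← take-<-split v i<j j≤v
    = b , Q , R , cong (c ∷_) v≡ , cong (c ∷_) take≡

  pigeonhole-prefixes : ∀ {n} (f : List A → Fin n) (v : List A) → n ≤ length v →
    ∃ λ P → ∃ λ b → ∃ λ Q → ∃ λ R → v ≡ P ++ b ∷ Q ++ R × f P ≡ f (P ++ b ∷ Q)
  pigeonhole-prefixes f v n≤v
    with i , j , i<j , fi≡fj ← pigeonhole (s≤s n≤v) (λ i → f (take (toℕ i) v))
    with b , Q , R , v≡ , take≡ ← take-<-split v i<j (≤-pred (toℕ<n j))
    = take (toℕ i) v , b , Q , R , v≡ , trans fi≡fj (cong f take≡)

  split-around-segment : ∀ (x y P : List A) q Q R → x ++ y ≡ P ++ q ∷ Q ++ R →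
    (∃ λ x′ → x ≡ P ++ q ∷ Q ++ x′ × R ≡ x′ ++ y) ⊎
    (∃ λ y₁ → ∃ λ c → ∃ λ y₂ → y ≡ y₁ ++ c ∷ y₂ × P ++ R ⊆ x ++ y₁ ++ y₂)
  split-around-segment [] y P q Q R y≡ =
    inj₂ (P , q , Q ++ R , y≡ , ++⁺ (⊆-refl {x = P}) (++⁺ˡ Q ⊆-refl))
  split-around-segment (c ∷ x) y (p ∷ P) q Q R e
    with refl , e′ ← ∷-injective e
    with split-around-segment x y P q Q R e′
  ... | inj₁ (x′ , x≡ , R≡)            = inj₁ (x′ , cong (c ∷_) x≡ , R≡)
  ... | inj₂ (y₁ , d , y₂ , y≡ , PR⊆) = inj₂ (y₁ , d , y₂ , y≡ , refl ∷ PR⊆)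
  split-around-segment (c ∷ x) y [] q [] R e
    with refl , xy≡R ← ∷-injective e
    = inj₁ (x , refl , sym xy≡R)
  split-around-segment (c ∷ x) y [] q (q′ ∷ Q) R e
    with refl , e′ ← ∷-injective e
    with split-around-segment x y [] q′ Q R e′
  ... | inj₁ (x′ , x≡ , R≡)           = inj₁ (x′ , cong (c ∷_) x≡ , R≡)
  ... | inj₂ (y₁ , d , y₂ , y≡ , R⊆) = inj₂ (y₁ , d , y₂ , y≡ , c ∷ʳ R⊆)

  any-sublist? : ∀ {P : List A → Set} → (∀ u → Dec (P u)) → ∀ w → Dec (∃ λ v → v ⊆ w × P v)
  any-sublist? P? [] = map′ (λ p → [] , [] , p) (λ { ([] , [] , p) → p }) (P? [])
  any-sublist? {P} P? (c ∷ w) with any-sublist? P? w | any-sublist? {P ∘ (c ∷_)} (P? ∘ (c ∷_)) w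
  ... | yes (v , v⊆w , p) | _                   = yes (v , c ∷ʳ v⊆w , p)
  ... | no _              | yes (v , v⊆w , p)   = yes (c ∷ v , refl ∷ v⊆w , p)
  ... | no ¬skip          | no ¬keep            =
    no λ { (v , _ ∷ʳ v⊆w , p) → ¬skip (v , v⊆w , p) ; (_ ∷ v , refl ∷ v⊆w , p) → ¬keep (v , v⊆w , p) }

any-word-≤? : ∀ {k} {P : List (Fin k) → Set} → (∀ u → Dec (P u)) →
              ∀ l → Dec (∃ λ w → length w ≤ l × P w)
any-word-≤? P? zero = map′ (λ p → [] , z≤n , p) (λ { ([] , _ , p) → p ; (_ ∷ _ , () , _) }) (P? [])
any-word-≤? {P = P} P? (suc l) with P? [] | any? (λ c → any-word-≤? {P = P ∘ (c ∷_)} (P? ∘ (c ∷_)) l)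
... | yes p | _                      = yes ([] , z≤n , p)
... | no _  | yes (c , w , w≤l , p) = yes (c ∷ w , s≤s w≤l , p)
... | no ¬p | no ¬q                  =
  no λ { ([] , _ , p) → ¬p p ; (c ∷ w , s≤s w≤l , p) → ¬q (c , w , w≤l , p) }

module Automaton {n k : ℕ} (M : DFA n k) where

  Word : Set
  Word = List (Fin k)

  state : Word → Fin n
  state = δ* M (start M)

  accepts? : ∀ u → Dec (Accepts M u)
  accepts? u = final M (state u) ≟ᵇ true

  state-cut-loop : ∀ P L z → state P ≡ state (P ++ L) → state (P ++ L ++ z) ≡ state (P ++ z)
  state-cut-loop P L z loop = begin
    state (P ++ L ++ z)          ≡⟨ cong state (++-assoc P L z) ⟨
    state ((P ++ L) ++ z)        ≡⟨ foldl-++ (δ M) (start M) (P ++ L) z ⟩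
    δ* M (state (P ++ L)) z      ≡⟨ cong (λ q → δ* M q z) loop ⟨
    δ* M (state P) z             ≡⟨ foldl-++ (δ M) (start M) P z ⟨
    state (P ++ z)               ∎

  accepts-cut-loop : ∀ P L z → state P ≡ state (P ++ L) → Accepts M (P ++ L ++ z) → Accepts M (P ++ z)
  accepts-cut-loop P L z loop = subst (λ q → final M q ≡ true) (state-cut-loop P L z loop)

  accepts-insert-loop : ∀ P L z → state P ≡ state (P ++ L) → Accepts M (P ++ z) → Accepts M (P ++ L ++ z)
  accepts-insert-loop P L z loop = subst (λ q → final M q ≡ true) (sym (state-cut-loop P L z loop))

  rejected-loop : ∀ {u} → n ≤ length u → ¬ Accepts M u →
    ∃ λ P → ∃ λ b → ∃ λ Q → ∃ λ R →
      u ≡ P ++ b ∷ Q ++ R × state P ≡ state (P ++ b ∷ Q) × ¬ Accepts M (P ++ R)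
  rejected-loop {u} n≤u ¬Lu
    with P , b , Q , R , u≡ , loop ← pigeonhole-prefixes state u n≤u
    = P , b , Q , R , u≡ , loop ,
      ¬Lu ∘ subst (Accepts M) (sym u≡) ∘ accepts-insert-loop P (b ∷ Q) R loop

  ShorterWitness : Word → Set
  ShorterWitness w = ∃[ v′ ] ∃[ w′ ] (Witness M v′ w′ × length w′ < length w)

  -- Indexed by the suffix after the deleted letter: its length is the termination measure.
  Deletion : Word → Word → Set
  Deletion w y = ∃[ x ] ∃[ a ] (w ≡ x ++ a ∷ y × ¬ Accepts M (x ++ y))

  shorter-if-loop-in-prefix : ∀ {x y P R} b Q x′ a →
    x ≡ P ++ b ∷ Q ++ x′ → R ≡ x′ ++ y → state P ≡ state (P ++ b ∷ Q) →
    Accepts M (x ++ a ∷ y) → ¬ Accepts M (P ++ R) → ShorterWitness (x ++ a ∷ y)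
  shorter-if-loop-in-prefix {y = y} {P} b Q x′ a refl refl loop Lw ¬LPR =
    P ++ x′ ++ y , P ++ x′ ++ a ∷ y ,
    (accepts-cut-loop P (b ∷ Q) (x′ ++ a ∷ y) loop (subst (Accepts M) w≡ Lw) ,
     ¬LPR , ++⁺ (⊆-refl {x = P}) (delete-⊆ x′ a y)) ,
    subst (λ u → length (P ++ x′ ++ a ∷ y) < length u) (sym w≡) (delete-segment-< P b Q (x′ ++ a ∷ y))
    where
      w≡ : (P ++ b ∷ Q ++ x′) ++ a ∷ y ≡ P ++ b ∷ Q ++ x′ ++ a ∷ y
      w≡ = trans (++-assoc P (b ∷ Q ++ x′) (a ∷ y)) (cong (λ t → P ++ b ∷ t) (++-assoc Q x′ (a ∷ y)))

  shorter-or-deletion-further-right : ∀ {x a y u} y₁ c y₂ → y ≡ y₁ ++ c ∷ y₂ →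
    Accepts M (x ++ a ∷ y) → u ⊆ x ++ y₁ ++ y₂ → ¬ Accepts M u →
    ShorterWitness (x ++ a ∷ y) ⊎ ∃[ y′ ] (length y′ < length y × Deletion (x ++ a ∷ y) y′)
  shorter-or-deletion-further-right {x} {a} {u = u} y₁ c y₂ refl Lw u⊆ ¬Lu =
    case accepts? (x₁ ++ y₂) of λ where
      (yes Lx₁y₂) → inj₁ (u , x₁ ++ y₂ , (Lx₁y₂ , ¬Lu , u⊆x₁y₂) , x₁y₂<w)
      (no ¬Lx₁y₂) → inj₂ (y₂ , length-++-≤ʳ (c ∷ y₂) {y₁} , x₁ , c , w≡ , ¬Lx₁y₂)
    where
      x₁ : Word
      x₁ = x ++ a ∷ y₁
      w≡ : x ++ a ∷ y₁ ++ c ∷ y₂ ≡ x₁ ++ c ∷ y₂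
      w≡ = sym (++-assoc x (a ∷ y₁) (c ∷ y₂))
      u⊆x₁y₂ : u ⊆ x₁ ++ y₂
      u⊆x₁y₂ = ⊆-trans u⊆ (subst (x ++ y₁ ++ y₂ ⊆_) (sym (++-assoc x (a ∷ y₁) y₂)) (delete-⊆ x a (y₁ ++ y₂)))
      x₁y₂<w : length (x₁ ++ y₂) < length (x ++ a ∷ y₁ ++ c ∷ y₂)
      x₁y₂<w = subst (λ t → length (x₁ ++ y₂) < length t) (sym w≡) (delete-segment-< x₁ c [] y₂)

  deletion-step : ∀ {w y} → Accepts M w → n < length w → Deletion w y →
    ShorterWitness w ⊎ ∃[ y′ ] (length y′ < length y × Deletion w y′)
  deletion-step {y = y} Lw n<w (x , a , refl , ¬Lxy)
    with P , b , Q , R , xy≡ , loop , ¬LPR ←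
           rejected-loop (≤-pred (subst (n <_) (length-insert x a y) n<w)) ¬Lxy
    with split-around-segment x y P b Q R xy≡
  ... | inj₁ (x′ , x≡ , R≡) = inj₁ (shorter-if-loop-in-prefix b Q x′ a x≡ R≡ loop Lw ¬LPR)
  ... | inj₂ (y₁ , c , y₂ , y≡ , PR⊆) = shorter-or-deletion-further-right y₁ c y₂ y≡ Lw PR⊆ ¬LPR

  deletion-shorter : ∀ {w y} → Accepts M w → n < length w → Deletion w y → ShorterWitness w
  deletion-shorter {w} Lw n<w del = go del (<-wellFounded _)
    where
      go : ∀ {y} → Deletion w y → Acc _<_ (length y) → ShorterWitness w
      go del (acc rs) with deletion-step Lw n<w del
      ... | inj₁ shorter               = shorter
      ... | inj₂ (y′ , y′<y , del′) = go del′ (rs y′<y)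

  witness-shorter : ∀ {v w} → Witness M v w → n < length w → ShorterWitness w
  witness-shorter {v} (Lw , ¬Lv , v⊆w) n<w
    with x , a , y , refl , v⊆xy ← ⊆-≢-deletion v⊆w (λ v≡w → ¬Lv (subst (Accepts M) (sym v≡w) Lw))
    with accepts? (x ++ y)
  ... | yes Lxy = v , x ++ y , (Lxy , ¬Lv , v⊆xy) , subst (length (x ++ y) <_) (sym (length-insert x a y)) (n<1+n _)
  ... | no ¬Lxy = deletion-shorter Lw n<w (x , a , refl , ¬Lxy)

  ShortWitness : Set
  ShortWitness = ∃[ v ] ∃[ w ] (Witness M v w × length w ≤ n)

  short-witness : ∀ {v w} → Witness M v w → ShortWitness
  short-witness wit = go wit (<-wellFounded _)
    where
      go : ∀ {v w} → Witness M v w → Acc _<_ (length w) → ShortWitness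
      go {v} {w} wit (acc rs) with length w ≤? n
      ... | yes w≤n = v , w , wit , w≤n
      ... | no w≰n
        with v′ , w′ , wit′ , w′<w ← witness-shorter wit (≰⇒> w≰n)
        = go wit′ (rs w′<w)

  -- SubwordClosed is only refuted, so a witness is found by exhaustive search up to length n.
  short-witness-if-not-closed : ¬ SubwordClosed M → ShortWitness
  short-witness-if-not-closed not-closed
    with any-word-≤? (λ w → accepts? w ×-dec any-sublist? (¬? ∘ accepts?) w) n
  ... | yes (w , w≤n , Lw , v , v⊆w , ¬Lv) = v , w , (Lw , ¬Lv , v⊆w) , w≤n
  ... | no none = ⊥-elim (not-closed closed)
    where
      closed : SubwordClosed M
      closed v w Lw v⊆w = decidable-stable (accepts? v) λ ¬Lv →
        let v′ , w′ , (Lw′ , ¬Lv′ , v′⊆w′) , w′≤n = short-witness (Lw , ¬Lv , v⊆w)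
        in none (w′ , w′≤n , Lw′ , v′ , v′⊆w′ , ¬Lv′)

[m%n+k]%n≡[m+k]%n : ∀ m k n .{{_ : NonZero n}} → (m % n + k) % n ≡ (m + k) % n
[m%n+k]%n≡[m+k]%n m k n = begin
  (m % n + k) % n           ≡⟨ %-distribˡ-+ (m % n) k n ⟩
  (m % n % n + k % n) % n   ≡⟨ cong (λ r → (r + k % n) % n) (m%n%n≡m%n m n) ⟩
  (m % n + k % n) % n       ≡⟨ %-distribˡ-+ m k n ⟨
  (m + k) % n               ∎

module Counter (m : ℕ) where

  counter : DFA (suc m) 1
  counter = record
    { δ     = λ q _ → suc (toℕ q) mod suc m
    ; start = Fin.zero
    ; final = λ q → isNo (toℕ q ≟ m)
    }

  toℕ-δ* : ∀ q u → toℕ (δ* counter q u) ≡ (toℕ q + length u) % suc m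
  toℕ-δ* q [] = sym (trans (cong (_% suc m) (+-identityʳ (toℕ q))) (m<n⇒m%n≡m (toℕ<n q)))
  toℕ-δ* q (_ ∷ u) = begin
    toℕ (δ* counter (suc (toℕ q) mod suc m) u)         ≡⟨ toℕ-δ* _ u ⟩
    (toℕ (suc (toℕ q) mod suc m) + length u) % suc m   ≡⟨ cong (λ r → (r + length u) % suc m) (toℕ-fromℕ< (m%n<n (suc (toℕ q)) (suc m))) ⟩
    (suc (toℕ q) % suc m + length u) % suc m           ≡⟨ [m%n+k]%n≡[m+k]%n (suc (toℕ q)) (length u) (suc m) ⟩
    (suc (toℕ q) + length u) % suc m                   ≡⟨ cong (_% suc m) (+-suc (toℕ q) (length u)) ⟨
    (toℕ q + suc (length u)) % suc m                   ∎

  accepts⇔ : ∀ u → Accepts counter u ⇔ length u % suc m ≢ m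
  accepts⇔ u = mk⇔
    (λ Lu → subst (_≢ m) (toℕ-δ* Fin.zero u) (toWitnessFalse (from T-≡ Lu)))
    (λ u≢m → to T-≡ (fromWitnessFalse (subst (_≢ m) (sym (toℕ-δ* Fin.zero u)) u≢m)))

  witness-long : ∀ {v w} → Witness counter v w → length w ≥ suc m
  witness-long {v} {w} (Lw , ¬Lv , v⊆w) = ≮⇒≥ λ w<1+m → to (accepts⇔ w) Lw (w%≡m w<1+m)
    where
      v%≡m : length v % suc m ≡ m
      v%≡m = decidable-stable (_ ≟ m) (¬Lv ∘ from (accepts⇔ v))
      w%≡m : length w < suc m → length w % suc m ≡ m
      w%≡m w<1+m = trans (m<n⇒m%n≡m w<1+m) (≤-antisym (≤-pred w<1+m) (subst (_≤ length w) v≡m v≤w))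
        where
          v≤w : length v ≤ length w
          v≤w = length-mono-≤ v⊆w
          v≡m : length v ≡ m
          v≡m = trans (sym (m<n⇒m%n≡m (≤-<-trans v≤w w<1+m))) v%≡m

  counter-not-closed : 0 < m → ¬ SubwordClosed counter
  counter-not-closed 0<m closed = to (accepts⇔ v) (closed v (Fin.zero ∷ v) Lw (Fin.zero ∷ʳ ⊆-refl)) v%≡m
    where
      v : List (Fin 1)
      v = replicate m Fin.zero
      v%≡m : length v % suc m ≡ m
      v%≡m = trans (cong (_% suc m) (length-replicate m)) (m<n⇒m%n≡m (n<1+n m))
      w%≡0 : length (Fin.zero ∷ v) % suc m ≡ 0
      w%≡0 = trans (cong (λ l → suc l % suc m) (length-replicate m)) (n%n≡0 (suc m))
      Lw : Accepts counter (Fin.zero ∷ v)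
      Lw = from (accepts⇔ (Fin.zero ∷ v)) (λ w%≡m → <⇒≢ 0<m (trans (sym w%≡0) w%≡m))

corollary6 : (n : ℕ) → n ≥ 2 →
    ((k : ℕ) (M : DFA n k) → ¬ SubwordClosed M →
    ∃[ v ] ∃[ w ] (Witness M v w × length w ≤ n))
    × (∃[ M ] (¬ SubwordClosed {n} {1} M ×
    (∀ v w → Witness M v w → length w ≥ n)))
corollary6 (suc (suc m)) _ =
  (λ k M → Automaton.short-witness-if-not-closed M) ,
  Counter.counter (suc m) , Counter.counter-not-closed (suc m) (s≤s z≤n) ,
  λ v w → Counter.witness-long (suc m)
corollary6 (suc zero) (s≤s ())
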